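{- Consider a normalized instance of \textsc{Constrained Layer Tree} with $\ell_i=0$ for all layers $i$. Let $a$ and $b$ be partial solutions with $a_0$ and $b_0$ leaves and branching layers $k_a,k_b$, and let $k$ be an integer with $\max\{k_a,k_b\}\le k\le\lambda-1$. Then the $k$-combination $c=(c_0,\dots,c_\lambda)$ of $a$ and $b$ is a partial solution with $a_0+b_0$ leaves if and only if $c_i\le n_i$ for every $i\in\{0,\dots,\lambda\}$ and $c_0\le u_{k+1}$.
   Context: A layer tree with layers $0,\dots,\lambda$ is a rooted tree whose leaves are in layer $0$, with exactly one root in layer $\lambda$, every edge going from a vertex in layer $i-1$ to its parent in layer $i$. The weight $w(v)$ of a vertex is the number of leaves in its subtree. An instance of \textsc{Constrained Layer Tree} is given by nonnegative integers $n_0$ and $(n_i,\ell_i,u_i)_{i\in\{1,\dots,\lambda\}}$; a layer tree is valid if it has at most $n_i$ vertices in layer $i$ for every $i$ and every vertex $v$ in layer $i\ge1$ satisfies $\ell_i\le w(v)\le u_i$. The instance is normalized if $n_i\le n_{i-1}$, $\ell_i\ge\ell_{i-1}$, $u_i\ge u_{i-1}$ for all $i\in\{1,\dots,\lambda\}$ (with $\ell_0=u_0=1$). A vector $a=(a_0,\dots,a_\lambda)\in\mathbb N^{\lambda+1}$ is a partial solution (with $a_0$ leaves) if there is a valid layer tree with exactly $a_i$ vertices in layer $i$ for each $i$. The branching layer of such a vector is the highest $i$ with $a_i>1$ (and $0$ if no such layer exists). For partial solutions $a,b$ with branching layers $k_a,k_b$ and $k\in\{\max\{k_a,k_b\},\dots,\lambda\}$,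 the $k$-combination of $a$ and $b$ is the vector $(a_0+b_0,\dots,a_k+b_k,1,\dots,1)$. -}

module Defs where

open import Data.Nat using (ℕ; zero; suc; _+_; _≤_; _<_; _⊔_)
open import Data.Nat.Properties using (_≟_; _<?_; _≤?_)
open import Data.List using (List; []; _∷_)
open import Data.List.Relation.Unary.All using (All)
open import Data.Product using (Σ; _×_; _,_)
open import Relation.Nullary using (yes; no)
open import Relation.Binary.PropositionalEquality using (_≡_)

-- A layer tree whose root sits in layer h.  Hence all leaves are in layer 0 and
-- every edge goes from layer i-1 to layer i.
data LTree : ℕ → Set where
  leaf : LTree zero
  node : ∀ {h} → LTree h → List (LTree h) → LTree (suc h)

mutual
  weight : ∀ {h} → LTree h → ℕ
  weight leaf = 1
  weight (node t ts) = weight t + weights ts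

  weights : ∀ {h} → List (LTree h) → ℕ
  weights [] = 0
  weights (t ∷ ts) = weight t + weights ts

mutual
  count : ∀ {h} → LTree h → ℕ → ℕ
  count leaf zero = 1
  count leaf (suc i) = 0
  count {suc h} (node t ts) i with i ≟ suc h
  ... | yes _ = 1
  ... | no _ = count t i + counts ts i

  counts : ∀ {h} → List (LTree h) → ℕ → ℕ
  counts [] i = 0
  counts (t ∷ ts) i = count t i + counts ts i

-- An instance of Constrained Layer Tree: λ, and n_i, ℓ_i, u_i.
-- Only the values n_0..n_λ and ℓ_1..ℓ_λ, u_1..u_λ are relevant.
record Instance : Set where
  field
    lam : ℕ
    n : ℕ → ℕ
    ℓ : ℕ → ℕ
    u : ℕ → ℕ
open Instance public

data WeightsOK (I : Instance) : ∀ {h} → LTree h → Set where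
  leafOK : WeightsOK I leaf
  nodeOK : ∀ {h} {t : LTree h} {ts : List (LTree h)} →
           ℓ I (suc h) ≤ weight (node t ts) →
           weight (node t ts) ≤ u I (suc h) →
           WeightsOK I t → All (WeightsOK I) ts →
           WeightsOK I (node t ts)

Valid : (I : Instance) → LTree (lam I) → Set
Valid I T = WeightsOK I T × (∀ i → i ≤ lam I → count T i ≤ n I i)

PartialSolution : (I : Instance) → (ℕ → ℕ) → Set
PartialSolution I a =
  Σ (LTree (lam I)) λ T → Valid I T × (∀ i → i ≤ lam I → count T i ≡ a i)

ℓ' : Instance → ℕ → ℕ
ℓ' I zero = 1
ℓ' I (suc i) = ℓ I (suc i)

u' : Instance → ℕ → ℕ
u' I zero = 1
u' I (suc i) = u I (suc i)

Normalized : Instance → Set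
Normalized I = ∀ i → suc i ≤ lam I →
  (n I (suc i) ≤ n I i) × (u' I i ≤ u I (suc i)) ×
  (1 ≤ i → ℓ' I i ≤ ℓ I (suc i))

branching : (ℕ → ℕ) → ℕ → ℕ
branching a zero = zero
branching a (suc i) with 1 <? a (suc i)
... | yes _ = suc i
... | no _ = branching a i

combination : ℕ → (ℕ → ℕ) → (ℕ → ℕ) → (ℕ → ℕ)
combination k a b i with i ≤? k
... | yes _ = a i + b i
... | no _ = 1

{-# OPTIONS --safe #-}
-- If c is realised by a tree, its single vertex in layer k+1 is an
-- ancestor of all c₀ leaves, so c₀ ≤ u_{k+1}.  Conversely, take trees for a and b,
-- hang all their vertices of layer k below one new vertex in layer k+1 and extend
-- it by a path up to layer λ.  Layers ≤ k are untouched, and with ℓ = 0 the only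
-- new weight constraints are c₀ ≤ u_i for i > k, which follow from c₀ ≤ u_{k+1}
-- since u is monotone.

module Submission where

open import Defs
open import Data.Nat using (ℕ; suc; _+_; _*_; _≤_; _<_; _⊔_; _≤′_; ≤′-refl; ≤′-step; z≤n; s≤s)
open import Data.Nat.Properties
open import Data.Product using (_×_; _,_; proj₁; proj₂)
open import Data.Sum using (inj₁; inj₂)
open import Data.List using (List; []; _∷_; _++_)
open import Data.List.NonEmpty using (List⁺; _∷_; [_]; toList; _⁺++_; _⁺++⁺_)
open import Data.List.Relation.Unary.All using (All; []; _∷_)
open import Data.List.Relation.Unary.All.Properties using (++⁺)
open import Function.Bundles using (_⇔_; mk⇔)
open import Relation.Nullary using (yes; no; contradiction)
open import Relation.Binary.PropositionalEquality using (_≡_; refl; sym; trans; cong; cong₂; subst; subst₂; module ≡-Reasoning)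

count-node-below : ∀ {h i} (t : LTree h) (ts : List (LTree h)) → i ≤ h →
  count (node t ts) i ≡ count t i + counts ts i
count-node-below {h} {i} t ts i≤h with i ≟ suc h
... | yes refl = contradiction i≤h (n≮n h)
... | no _ = refl

count-node-top : ∀ {h} (t : LTree h) (ts : List (LTree h)) → count (node t ts) (suc h) ≡ 1
count-node-top {h} t ts with suc h ≟ suc h
... | yes _ = refl
... | no ≢ = contradiction refl ≢

count-root : ∀ {h} (T : LTree h) → count T h ≡ 1
count-root leaf = refl
count-root (node t ts) = count-node-top t ts

counts-++ : ∀ {h} (xs ys : List (LTree h)) i → counts (xs ++ ys) i ≡ counts xs i + counts ys i
counts-++ [] ys i = refl
counts-++ (x ∷ xs) ys i = trans (cong (count x i +_) (counts-++ xs ys i)) (sym (+-assoc (count x i) _ _))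

mutual
  count-zero≡weight : ∀ {h} (T : LTree h) → count T 0 ≡ weight T
  count-zero≡weight leaf = refl
  count-zero≡weight (node t ts) = trans (count-node-below t ts z≤n) (cong₂ _+_ (count-zero≡weight t) (counts-zero≡weights ts))

  counts-zero≡weights : ∀ {h} (ts : List (LTree h)) → counts ts 0 ≡ weights ts
  counts-zero≡weights [] = refl
  counts-zero≡weights (t ∷ ts) = cong₂ _+_ (count-zero≡weight t) (counts-zero≡weights ts)

mutual
  weight≤count*u : ∀ {I h m} {T : LTree h} → WeightsOK I T → suc m ≤ h →
    weight T ≤ count T (suc m) * u I (suc m)
  weight≤count*u {I} {m = m} {node t ts} (nodeOK _ w≤u okt okts) m<h with m≤n⇒m<n∨m≡n m<h
  ... | inj₂ refl rewrite count-node-top t ts = subst (weight (node t ts) ≤_) (sym (*-identityˡ _)) w≤u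
  ... | inj₁ (s≤s m<h′) rewrite count-node-below t ts m<h′ | *-distribʳ-+ (u I (suc m)) (count t (suc m)) (counts ts (suc m)) =
    +-mono-≤ (weight≤count*u okt m<h′) (weights≤counts*u okts m<h′)

  weights≤counts*u : ∀ {I h m} {ts : List (LTree h)} → All (WeightsOK I) ts → suc m ≤ h →
    weights ts ≤ counts ts (suc m) * u I (suc m)
  weights≤counts*u [] m<h = z≤n
  weights≤counts*u {I} {m = m} {t ∷ ts} (okt ∷ okts) m<h
    rewrite *-distribʳ-+ (u I (suc m)) (count t (suc m)) (counts ts (suc m)) =
    +-mono-≤ (weight≤count*u okt m<h) (weights≤counts*u okts m<h)

-- The subtrees of a tree rooted in layer j, left to right; non-empty, so that they
-- can become the children of one new vertex.
mutual
  cut : ∀ {j h} → j ≤′ h → LTree h → List⁺ (LTree j)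
  cut ≤′-refl T = [ T ]
  cut (≤′-step j≤h) (node t ts) = cut j≤h t ⁺++ cutAll j≤h ts

  cutAll : ∀ {j h} → j ≤′ h → List (LTree h) → List (LTree j)
  cutAll j≤h [] = []
  cutAll j≤h (t ∷ ts) = toList (cut j≤h t) ++ cutAll j≤h ts

mutual
  counts-cut : ∀ {i j h} (j≤h : j ≤′ h) (T : LTree h) → i ≤ j → counts (toList (cut j≤h T)) i ≡ count T i
  counts-cut ≤′-refl T i≤j = +-identityʳ _
  counts-cut {i} (≤′-step j≤h) (node t ts) i≤j = begin
    counts (toList (cut j≤h t) ++ cutAll j≤h ts) i   ≡⟨ counts-++ (toList (cut j≤h t)) _ i ⟩
    counts (toList (cut j≤h t)) i + counts (cutAll j≤h ts) i
                                                     ≡⟨ cong₂ _+_ (counts-cut j≤h t i≤j) (counts-cutAll j≤h ts i≤j) ⟩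
    count t i + counts ts i                          ≡⟨ count-node-below t ts (≤-trans i≤j (≤′⇒≤ j≤h)) ⟨
    count (node t ts) i                              ∎
    where open ≡-Reasoning

  counts-cutAll : ∀ {i j h} (j≤h : j ≤′ h) (ts : List (LTree h)) → i ≤ j → counts (cutAll j≤h ts) i ≡ counts ts i
  counts-cutAll j≤h [] i≤j = refl
  counts-cutAll {i} j≤h (t ∷ ts) i≤j = trans (counts-++ (toList (cut j≤h t)) _ i)
    (cong₂ _+_ (counts-cut j≤h t i≤j) (counts-cutAll j≤h ts i≤j))

mutual
  WeightsOK-cut : ∀ {I j h} (j≤h : j ≤′ h) {T : LTree h} → WeightsOK I T → All (WeightsOK I) (toList (cut j≤h T))
  WeightsOK-cut ≤′-refl ok = ok ∷ []
  WeightsOK-cut (≤′-step j≤h) (nodeOK _ _ okt okts) = ++⁺ (WeightsOK-cut j≤h okt) (WeightsOK-cutAll j≤h okts)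

  WeightsOK-cutAll : ∀ {I j h} (j≤h : j ≤′ h) {ts : List (LTree h)} → All (WeightsOK I) ts → All (WeightsOK I) (cutAll j≤h ts)
  WeightsOK-cutAll j≤h [] = []
  WeightsOK-cutAll j≤h (ok ∷ oks) = ++⁺ (WeightsOK-cut j≤h ok) (WeightsOK-cutAll j≤h oks)

stem : ∀ {j h} → j ≤′ h → LTree j → LTree h
stem ≤′-refl t = t
stem (≤′-step j≤h) t = node (stem j≤h t) []

weight-stem : ∀ {j h} (j≤h : j ≤′ h) (t : LTree j) → weight (stem j≤h t) ≡ weight t
weight-stem ≤′-refl t = refl
weight-stem (≤′-step j≤h) t = trans (+-identityʳ _) (weight-stem j≤h t)

count-stem-below : ∀ {i j h} (j≤h : j ≤′ h) (t : LTree j) → i ≤ j → count (stem j≤h t) i ≡ count t i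
count-stem-below ≤′-refl t i≤j = refl
count-stem-below (≤′-step j≤h) t i≤j =
  trans (count-node-below (stem j≤h t) [] (≤-trans i≤j (≤′⇒≤ j≤h)))
        (trans (+-identityʳ _) (count-stem-below j≤h t i≤j))

count-stem-above : ∀ {i j h} (j≤h : j ≤′ h) (t : LTree j) → j ≤ i → i ≤ h → count (stem j≤h t) i ≡ 1
count-stem-above ≤′-refl t j≤i i≤h rewrite ≤-antisym j≤i i≤h = count-root t
count-stem-above (≤′-step j≤h) t j≤i i≤h with m≤n⇒m<n∨m≡n i≤h
... | inj₂ refl = count-node-top (stem j≤h t) []
... | inj₁ (s≤s i≤h′) = trans (count-node-below (stem j≤h t) [] i≤h′)
                              (trans (+-identityʳ _) (count-stem-above j≤h t j≤i i≤h′))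

WeightsOK-stem : ∀ {I j h} (j≤h : j ≤′ h) {t : LTree j} → WeightsOK I t →
  (∀ m → j < m → m ≤ h → ℓ I m ≤ weight t × weight t ≤ u I m) → WeightsOK I (stem j≤h t)
WeightsOK-stem ≤′-refl ok bounds = ok
WeightsOK-stem {I} (≤′-step {h} j≤h) {t} ok bounds
  with bounds (suc h) (s≤s (≤′⇒≤ j≤h)) ≤-refl
... | ℓ≤w , w≤u = nodeOK (subst (ℓ I (suc h) ≤_) (sym w≡) ℓ≤w) (subst (_≤ u I (suc h)) (sym w≡) w≤u)
  (WeightsOK-stem j≤h ok (λ m j<m m≤h → bounds m j<m (m≤n⇒m≤1+n m≤h))) []
  where w≡ = weight-stem (≤′-step j≤h) t

graft : ∀ {h} → List⁺ (LTree h) → LTree (suc h)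
graft (t ∷ ts) = node t ts

joinAt : ∀ {k h} → k ≤′ h → LTree h → LTree h → LTree (suc k)
joinAt k≤h Ta Tb = graft (cut k≤h Ta ⁺++⁺ cut k≤h Tb)

count-joinAt : ∀ {i k h} (k≤h : k ≤′ h) (Ta Tb : LTree h) → i ≤ k →
  count (joinAt k≤h Ta Tb) i ≡ count Ta i + count Tb i
count-joinAt {i} k≤h Ta Tb i≤k with cut k≤h Ta | cut k≤h Tb | counts-cut k≤h Ta i≤k | counts-cut k≤h Tb i≤k
... | t ∷ ts | La | ≡a | ≡b = begin
  count (node t (ts ++ toList La)) i            ≡⟨ count-node-below t _ i≤k ⟩
  counts (t ∷ ts ++ toList La) i                ≡⟨ counts-++ (t ∷ ts) (toList La) i ⟩
  counts (t ∷ ts) i + counts (toList La) i      ≡⟨ cong₂ _+_ ≡a ≡b ⟩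
  count Ta i + count Tb i                       ∎
  where open ≡-Reasoning

WeightsOK-joinAt : ∀ {I k h} (k≤h : k ≤′ h) {Ta Tb : LTree h} → WeightsOK I Ta → WeightsOK I Tb →
  ℓ I (suc k) ≤ weight (joinAt k≤h Ta Tb) → weight (joinAt k≤h Ta Tb) ≤ u I (suc k) →
  WeightsOK I (joinAt k≤h Ta Tb)
WeightsOK-joinAt k≤h {Ta} {Tb} okA okB ℓ≤w w≤u
  with cut k≤h Ta | cut k≤h Tb | WeightsOK-cut k≤h okA | WeightsOK-cut k≤h okB
... | t ∷ ts | _ | okt ∷ okts | okLb = nodeOK ℓ≤w w≤u okt (++⁺ okts okLb)

combination-≤ : ∀ {i} k a b → i ≤ k → combination k a b i ≡ a i + b i
combination-≤ {i} k a b i≤k with i ≤? k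
... | yes _ = refl
... | no i≰k = contradiction i≤k i≰k

combination-> : ∀ {i} k a b → k < i → combination k a b i ≡ 1
combination-> {i} k a b k<i with i ≤? k
... | yes i≤k = contradiction i≤k (<⇒≱ k<i)
... | no _ = refl

u-mono : ∀ {I k m} → Normalized I → k < m → m ≤ lam I → u I (suc k) ≤ u I m
u-mono {I} norm (s≤s k≤m) m≤λ = go (≤⇒≤′ k≤m) m≤λ
  where
  go : ∀ {k m} → k ≤′ m → suc m ≤ lam I → u I (suc k) ≤ u I (suc m)
  go ≤′-refl _ = ≤-refl
  go (≤′-step {m} k≤m) m<λ = ≤-trans (go k≤m (<⇒≤ m<λ)) (proj₁ (proj₂ (norm (suc m) m<λ)))

leaves≤count*u : ∀ {I a m} → PartialSolution I a → suc m ≤ lam I → a 0 ≤ a (suc m) * u I (suc m)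
leaves≤count*u {I} {m = m} (T , (ok , _) , T≡a) m<λ =
  subst₂ (λ x y → x ≤ y * u I (suc m)) (trans (sym (count-zero≡weight T)) (T≡a 0 z≤n)) (T≡a (suc m) m<λ)
    (weight≤count*u ok m<λ)

combination-bounded : ∀ {I a b k} → PartialSolution I (combination k a b) → k < lam I →
  (∀ i → i ≤ lam I → combination k a b i ≤ n I i) × combination k a b 0 ≤ u I (suc k)
combination-bounded {I} {a} {b} {k} c@(T , (_ , T≤n) , T≡c) k<λ =
  (λ i i≤λ → subst (_≤ n I i) (T≡c i i≤λ) (T≤n i i≤λ)) , c₀≤u
  where
  open ≤-Reasoning
  c₀≤u : combination k a b 0 ≤ u I (suc k)
  c₀≤u = begin
    combination k a b 0                         ≤⟨ leaves≤count*u c k<λ ⟩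
    combination k a b (suc k) * u I (suc k)     ≡⟨ cong (_* u I (suc k)) (combination-> k a b ≤-refl) ⟩
    1 * u I (suc k)                             ≡⟨ *-identityˡ _ ⟩
    u I (suc k)                                 ∎

combination-PartialSolution : ∀ {I a b k} → Normalized I → (∀ i → 1 ≤ i → i ≤ lam I → ℓ I i ≡ 0) →
  PartialSolution I a → PartialSolution I b → k < lam I →
  (∀ i → i ≤ lam I → combination k a b i ≤ n I i) → combination k a b 0 ≤ u I (suc k) →
  PartialSolution I (combination k a b)
combination-PartialSolution {I} {a} {b} {k} norm ℓ≡0
  (Ta , (okA , _) , Ta≡a) (Tb , (okB , _) , Tb≡b) k<λ c≤n c₀≤u =
  T , (okT , λ i i≤λ → subst (_≤ n I i) (sym (T≡c i i≤λ)) (c≤n i i≤λ)) , T≡c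
  where
  k≤λ = ≤⇒≤′ (<⇒≤ k<λ)
  top = joinAt k≤λ Ta Tb
  k<′λ = ≤⇒≤′ k<λ
  T = stem k<′λ top

  top≡c : ∀ i → i ≤ k → count top i ≡ combination k a b i
  top≡c i i≤k = trans (count-joinAt k≤λ Ta Tb i≤k)
    (trans (cong₂ _+_ (Ta≡a i (≤-trans i≤k (<⇒≤ k<λ))) (Tb≡b i (≤-trans i≤k (<⇒≤ k<λ))))
           (sym (combination-≤ k a b i≤k)))

  T≡c : ∀ i → i ≤ lam I → count T i ≡ combination k a b i
  T≡c i i≤λ with ≤-<-connex i k
  ... | inj₁ i≤k = trans (count-stem-below k<′λ top (m≤n⇒m≤1+n i≤k)) (top≡c i i≤k)
  ... | inj₂ k<i = trans (count-stem-above k<′λ top k<i i≤λ) (sym (combination-> k a b k<i))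

  top≤u : weight top ≤ u I (suc k)
  top≤u = subst (_≤ u I (suc k)) (trans (sym (top≡c 0 z≤n)) (count-zero≡weight top)) c₀≤u

  ℓ≤ : ∀ {m} → k < m → m ≤ lam I → ∀ w → ℓ I m ≤ w
  ℓ≤ k<m m≤λ w = subst (_≤ w) (sym (ℓ≡0 _ (≤-trans (s≤s z≤n) k<m) m≤λ)) z≤n

  okT : WeightsOK I T
  okT = WeightsOK-stem k<′λ
    (WeightsOK-joinAt k≤λ okA okB (ℓ≤ ≤-refl k<λ _) top≤u)
    (λ m k+1<m m≤λ → ℓ≤ (<⇒≤ k+1<m) m≤λ _ , ≤-trans top≤u (u-mono norm (<⇒≤ k+1<m) m≤λ))

lemma3p2 : (I : Instance) → Normalized I →
    (∀ i → 1 ≤ i → i ≤ lam I → ℓ I i ≡ 0) →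
    (a b : ℕ → ℕ) → PartialSolution I a → PartialSolution I b →
    (k : ℕ) → branching a (lam I) ⊔ branching b (lam I) ≤ k → suc k ≤ lam I →
    (PartialSolution I (combination k a b) ⇔
    ((∀ i → i ≤ lam I → combination k a b i ≤ n I i) ×
    combination k a b 0 ≤ u I (suc k)))
lemma3p2 I norm ℓ≡0 a b psa psb k _ k<λ =
  mk⇔ (λ c → combination-bounded c k<λ)
      (λ (c≤n , c₀≤u) → combination-PartialSolution norm ℓ≡0 psa psb k<λ c≤n c₀≤u)
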